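{- Let $\alpha\in\{+,-\}$ and let $G$ be a bidirected graph with a vertex $r\in V(G)$ such that $G$ has no loop at $r$ and no $-\alpha$-ditrail from $x$ to $r$ exists for any $x\in V(G)$ except the trivial ditrail $(r)$. Let $x\in V(G)$ and let $P$ be an $(\alpha,\alpha)$-ditrail from $x$ to $r$. Then for any vertex term $w$ of $P$ other than the last one, $xPw$ is an $(\alpha,-\alpha)$-ditrail from $x$ to $w$ and $wPr$ is an $(\alpha,\alpha)$-ditrail from $w$ to $r$. Accordingly, every edge of $P$ except the last one is an $(\alpha,-\alpha)$-edge, whereas the last edge is an $(\alpha,\alpha)$-edge.
   Context: A bidirected graph $G$ is a finite graph (loops and parallel edges allowed) with maps $\partial_+,\partial_-:E(G)\to 2^{V(G)}$ such that for each edge $e$ with (possibly identical) ends $u,v$: $\partial_\alpha(e)\subseteq\{u,v\}$, $\partial_+(e)\cup\partial_-(e)=\{u,v\}$, and $\partial_+(e)\cap\partial_-(e)=\emptyset$ if $e$ is not a loop. If $u\in\partial_\alpha(e)$, the sign of $u$ over $e$ is $\alpha$; $-\alpha$ denotes the opposite sign. An edge is an $(\alpha,\alpha)$-edge if all its ends have sign $\alpha$ over it, and an $(\alpha,-\alpha)$-edge (equivalently a $(+,-)$-edge) if both $\partial_+(e)$ and $\partial_-(e)$ are nonempty. A walk is a sequence $W=(w_1,\dots,w_k)$, $k$ odd, with $w_i$ a vertex for odd $i$ and $w_i$ an edge joining $w_{i-1},w_{i+1}$ for even $i$; the entries are its terms, odd-indexed ones vertex terms; for vertex terms $t_i,t_j$,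 $i\le j$, $t_iWt_j$ denotes the subwalk $(w_i,\dots,w_j)$. A trail has no repeated edge. $W$ is a diwalk if to each traversal of an edge $w_i$ one can assign signs to its end-occurrences equal to the signs of these vertices over $w_i$ (for a loop with one end $+$ and one end $-$, the two assigned signs are distinct), such that at every internal vertex term the signs assigned from the preceding and following edges are distinct. A ditrail is a diwalk that is a trail. For $k\ge3$ the sign of $w_1$ (resp. $w_k$) over $W$ is the sign assigned at $w_2$ (resp. $w_{k-1}$); $W$ is an $(\alpha,\beta)$-ditrail if these are $\alpha,\beta$, and an $\alpha$-ditrail if it is an $(\alpha,\beta)$-ditrail for some $\beta$; the trivial ditrail $(v)$ counts as both a $(+,-)$- and a $(-,+)$-ditrail. -}

module Defs where

open import Data.Nat using (ℕ; zero; suc)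
open import Data.Fin using (Fin)
open import Data.Fin.Subset using (Subset; _∈_)
open import Data.List using (List; []; _∷_)
open import Data.List.Relation.Unary.Unique.Propositional using (Unique)
open import Data.Product using (_×_; _,_; ∃; proj₁)
open import Data.Sum using (_⊎_)
open import Data.Empty using (⊥)
open import Relation.Binary.PropositionalEquality using (_≡_; _≢_)
open import Data.List using (map)

data Sign : Set where
  ⊕ ⊖ : Sign

neg : Sign → Sign
neg ⊕ = ⊖
neg ⊖ = ⊕

-- A finite bidirected graph, following the paper's definition literally:
-- vertices Fin nV, edges Fin nE, each edge e has (possibly identical) ends
-- end₁ e, end₂ e, and ∂ α e ⊆ V(G) is the set ∂_α(e).
record BiGraph : Set where
  field
    nV nE  : ℕ
    end₁   : Fin nE → Fin nV
    end₂   : Fin nE → Fin nV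
    ∂      : Sign → Fin nE → Subset nV
    ∂⊆ends : ∀ α e w → w ∈ ∂ α e → w ≡ end₁ e ⊎ w ≡ end₂ e
    ∂cover₁ : ∀ e → end₁ e ∈ ∂ ⊕ e ⊎ end₁ e ∈ ∂ ⊖ e
    ∂cover₂ : ∀ e → end₂ e ∈ ∂ ⊕ e ⊎ end₂ e ∈ ∂ ⊖ e
    ∂disj  : ∀ e → end₁ e ≢ end₂ e → ∀ w → w ∈ ∂ ⊕ e → w ∈ ∂ ⊖ e → ⊥

module _ (G : BiGraph) where
  open BiGraph G

  V : Set
  V = Fin nV

  E : Set
  E = Fin nE

  Joins : E → V → V → Set
  Joins e a b = (a ≡ end₁ e × b ≡ end₂ e) ⊎ (a ≡ end₂ e × b ≡ end₁ e)

  MixedLoop : E → Set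
  MixedLoop e = end₁ e ≡ end₂ e × end₁ e ∈ ∂ ⊕ e × end₁ e ∈ ∂ ⊖ e

  TravOK : V → E → V → Sign → Sign → Set
  TravOK a e b s t =
    Joins e a b × a ∈ ∂ s e × b ∈ ∂ t e × (MixedLoop e → s ≢ t)

  -- A walk (w₁,…,w_k) is represented by its first vertex x together with the
  -- list of (edge, next vertex) pairs ((w₂,w₃),(w₄,w₅),…).
  Steps : Set
  Steps = List (E × V)

  endV : V → Steps → V
  endV x []            = x
  endV x ((_ , v) ∷ s) = endV v s

  -- vertex term number i (0-based) of the walk
  vertexAt : V → Steps → ℕ → V
  vertexAt x []            _       = x
  vertexAt x _             zero    = x
  vertexAt x ((_ , v) ∷ s) (suc i) = vertexAt v s i

  -- Di a steps s t : the nontrivial walk starting at a with the given steps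
  -- admits a sign assignment making it a diwalk, where the sign of the first
  -- vertex over it is s and the sign of the last vertex over it is t.
  data Di : V → Steps → Sign → Sign → Set where
    one  : ∀ {a e b s t} → TravOK a e b s t → Di a ((e , b) ∷ []) s t
    cons : ∀ {a e b s u u' t st} → TravOK a e b s u → u' ≢ u →
           Di b st u' t → Di a ((e , b) ∷ st) s t

  Trail : Steps → Set
  Trail st = Unique (map proj₁ st)

  -- W = (x, st) is an (α,β)-ditrail from x to y
  -- (the trivial ditrail (x) counts as both a (+,−)- and a (−,+)-ditrail)
  SignedDitrail : Sign → Sign → V → Steps → V → Set
  SignedDitrail α β x st y =
    Trail st × endV x st ≡ y ×
    ((st ≡ [] × β ≡ neg α) ⊎ Di x st α β)

  NoLoopAt : V → Set
  NoLoopAt r = ∀ e → end₁ e ≡ r → end₂ e ≡ r → ⊥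

  PMEdge : E → Set
  PMEdge e = ∃ (λ w → w ∈ ∂ ⊕ e) × ∃ (λ w → w ∈ ∂ ⊖ e)

  AAEdge : Sign → E → Set
  AAEdge α e = end₁ e ∈ ∂ α e × end₂ e ∈ ∂ α e

-- Write an (α,α)-ditrail P from x to r as a first traversal a —e→ b with
-- signs (s,u) followed by a ditrail R from b whose sign at b is u' ≠ u and
-- whose sign at r is α.  Since P is a trail ending at r, so is R; by the
-- hypothesis on r the sign u' cannot be −α, hence u' = α and u = −α
-- ('entry-sign').  Thus at every internal vertex term P enters with sign −α
-- and leaves with sign α.
module Submission where

open import Defs
open import Data.Nat using (ℕ; _<_; zero; suc; s≤s)
open import Data.List using ([]; _∷_; _++_; length; take; drop)
open import Data.List.Properties using (take-map; ∷-injective)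
open import Data.List.Relation.Unary.All using (All; []; _∷_)
open import Data.List.Relation.Unary.AllPairs as AllPairs using ([])
open import Data.List.Relation.Unary.Unique.Propositional using (Unique)
open import Data.List.Relation.Unary.Unique.Propositional.Properties using (take⁺)
open import Data.Product using (_×_; _,_; proj₁; proj₂)
open import Data.Sum using (_⊎_; inj₁; inj₂)
open import Data.Empty using (⊥-elim)
open import Relation.Binary.PropositionalEquality using (_≡_; _≢_; refl; subst)

neg-irrefl : ∀ α → α ≢ neg α
neg-irrefl ⊕ ()
neg-irrefl ⊖ ()

sign-cases : ∀ α s → s ≡ α ⊎ s ≡ neg α
sign-cases ⊕ ⊕ = inj₁ refl
sign-cases ⊕ ⊖ = inj₂ refl
sign-cases ⊖ ⊕ = inj₂ refl
sign-cases ⊖ ⊖ = inj₁ refl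

≢⇒neg : ∀ {s t} → s ≢ t → t ≡ neg s
≢⇒neg {⊕} {⊕} s≢t = ⊥-elim (s≢t refl)
≢⇒neg {⊕} {⊖} _   = refl
≢⇒neg {⊖} {⊕} _   = refl
≢⇒neg {⊖} {⊖} s≢t = ⊥-elim (s≢t refl)

module _ (G : BiGraph) where

  Trail-take : ∀ n {st} → Trail G st → Trail G (take n st)
  Trail-take n {st} tr = subst Unique (take-map {f = proj₁} n st) (take⁺ n tr)

  Di-nonempty : ∀ {a st s t} → Di G a st s t → st ≢ []
  Di-nonempty (one _)      ()
  Di-nonempty (cons _ _ _) ()

  -- Gluing a traversal a —e→ b with signs (s,u) in front of a (u',t)-ditrail
  -- from b, where u' ≠ u, gives an (s,t)-diwalk; if the ditrail is trivial
  -- then t = −u' = u, so the single traversal already has the right signs.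
  Di-extend : ∀ {a e b s u u' t st} → TravOK G a e b s u → u' ≢ u →
    (st ≡ [] × t ≡ neg u') ⊎ Di G b st u' t → Di G a ((e , b) ∷ st) s t
  Di-extend trav u'≢u (inj₁ (refl , refl)) rewrite ≢⇒neg u'≢u = one trav
  Di-extend trav u'≢u (inj₂ d) = cons trav u'≢u d

  TravOK-PMEdge : ∀ {a e b} s → TravOK G a e b s (neg s) → PMEdge G e
  TravOK-PMEdge ⊕ (_ , a∈ , b∈ , _) = (_ , a∈) , (_ , b∈)
  TravOK-PMEdge ⊖ (_ , a∈ , b∈ , _) = (_ , b∈) , (_ , a∈)

  TravOK-AAEdge : ∀ {a e b} α → TravOK G a e b α α → AAEdge G α e
  TravOK-AAEdge α (inj₁ (refl , refl) , a∈ , b∈ , _) = a∈ , b∈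
  TravOK-AAEdge α (inj₂ (refl , refl) , a∈ , b∈ , _) = b∈ , a∈

  module _ (α : Sign) (r : V G)
    (no-neg-ditrail : ∀ (y : V G) (W : Steps G) (β : Sign) →
                      SignedDitrail G (neg α) β y W r → W ≡ []) where

    entry-sign : ∀ {e b u u' st} → Trail G ((e , b) ∷ st) →
      endV G b st ≡ r → u' ≢ u → Di G b st u' α → u' ≡ α × u ≡ neg α
    entry-sign {u' = u'} tr end u'≢u rest with sign-cases α u'
    ... | inj₁ refl = refl , ≢⇒neg u'≢u
    ... | inj₂ refl =
      ⊥-elim (Di-nonempty rest (no-neg-ditrail _ _ α (AllPairs.tail tr , end , inj₂ rest)))

    suffix-ditrail : ∀ {a st} → Di G a st α α → Trail G st → endV G a st ≡ r →
      (i : ℕ) → i < length st →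
      SignedDitrail G α α (vertexAt G a st i) (drop i st) r
    suffix-ditrail {st = _ ∷ _} d tr end zero _ = tr , end , inj₂ d
    suffix-ditrail (one _) tr end (suc i) (s≤s ())
    suffix-ditrail (cons trav u'≢u rest) tr end (suc i) (s≤s i<)
      with entry-sign tr end u'≢u rest
    ... | refl , _ = suffix-ditrail rest (AllPairs.tail tr) end i i<

    prefix-ditrail : ∀ {a st} → Di G a st α α → Trail G st → endV G a st ≡ r →
      (i : ℕ) → i < length st →
      SignedDitrail G α (neg α) a (take i st) (vertexAt G a st i)
    prefix-ditrail {st = _ ∷ _} _ _ _ zero _ = [] , refl , inj₁ (refl , refl)
    prefix-ditrail (one _) tr end (suc i) (s≤s ())
    prefix-ditrail {st = st} (cons trav u'≢u rest) tr end (suc i) (s≤s i<)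
      with entry-sign tr end u'≢u rest
    ... | refl , _ with prefix-ditrail rest (AllPairs.tail tr) end i i<
    ... | _ , prefix-end , prefix-di =
      Trail-take (suc i) {st} tr , prefix-end , inj₂ (Di-extend trav u'≢u prefix-di)

    edge-types : ∀ {a st} → Di G a st α α → Trail G st → endV G a st ≡ r →
      ∀ (Q : Steps G) (e : E G) (v : V G) → st ≡ Q ++ ((e , v) ∷ []) →
      All (λ s → PMEdge G (proj₁ s)) Q × AAEdge G α e
    edge-types (one trav) _ _ [] _ _ refl = [] , TravOK-AAEdge α trav
    edge-types (one _) _ _ (_ ∷ []) _ _ ()
    edge-types (one _) _ _ (_ ∷ _ ∷ _) _ _ ()
    edge-types (cons _ _ rest) _ _ [] _ _ eq =
      ⊥-elim (Di-nonempty rest (proj₂ (∷-injective eq)))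
    edge-types (cons trav u'≢u rest) tr end (_ ∷ Q) e v eq
      with ∷-injective eq | entry-sign tr end u'≢u rest
    ... | refl , rest≡ | refl , refl
      with edge-types rest (AllPairs.tail tr) end Q e v rest≡
    ... | interior , last = TravOK-PMEdge α trav ∷ interior , last

-- The trivial ditrail is never an (α,α)-ditrail, so P is a diwalk and the
-- three facts above give the claims.
lemma11p3 : (G : BiGraph) (α : Sign) (r : V G) →
    NoLoopAt G r →
    (∀ (y : V G) (W : Steps G) (β : Sign) → SignedDitrail G (neg α) β y W r → W ≡ []) →
    (x : V G) (P : Steps G) → SignedDitrail G α α x P r →
    ((i : ℕ) → i < length P →
      SignedDitrail G α (neg α) x (take i P) (vertexAt G x P i)
      × SignedDitrail G α α (vertexAt G x P i) (drop i P) r)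
    × (∀ (Q : Steps G) (e : E G) (v : V G) → P ≡ Q ++ ((e , v) ∷ []) →
      All (λ s → PMEdge G (proj₁ s)) Q × AAEdge G α e)
lemma11p3 G α r _ H x P (_ , _ , inj₁ (_ , α≡negα)) = ⊥-elim (neg-irrefl α α≡negα)
lemma11p3 G α r _ H x P (tr , end , inj₂ d) =
  (λ i i< → prefix-ditrail G α r H d tr end i i< , suffix-ditrail G α r H d tr end i i<)
  , edge-types G α r H d tr end
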